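{- Let $X$ be a finite non-empty set and $R$ a monotone transit function on $X$ satisfying (wp): for all $u,v,x,y,p,q\in X$, if $R(u,v)\cap R(x,y)$, $R(u,v)\cap R(p,q)$ and $R(x,y)\cap R(p,q)$ are all non-empty, then $R(p,q)\subseteq R(u,v)\cup R(x,y)$ or $R(u,v)\subseteq R(p,q)\cup R(x,y)$ or $R(x,y)\subseteq R(p,q)\cup R(u,v)$. Then $R$ satisfies (o'): for all $u,v\in X$ and every $z\in R(u,v)$ there exist $p,q\in R(u,v)$ such that $R(p,z)\cup R(z,q)=R(u,v)$.
   Context: A transit function on a finite non-empty set $X$ is a map $R:X\times X\to 2^X$ such that for all $u,v\in X$: $u\in R(u,v)$, $R(u,v)=R(v,u)$, and $R(u,u)=\{u\}$. $R$ is monotone if for all $u,v,p,q\in X$, $p,q\in R(u,v)$ implies $R(p,q)\subseteq R(u,v)$. -}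

module Defs where

open import Data.Nat using (ℕ; suc)
open import Data.Fin using (Fin)
open import Data.Fin.Subset using (Subset; _∈_; _⊆_; _∪_; _∩_; ⁅_⁆; Nonempty)
open import Data.Product using (_×_; ∃₂)
open import Data.Sum using (_⊎_)
open import Relation.Binary.PropositionalEquality using (_≡_)

-- A finite non-empty set X is modelled as Fin (suc m).
-- A map R : X × X → 2^X is modelled as a function into Subset (suc m).
Fun : ℕ → Set
Fun n = Fin n → Fin n → Subset n

IsTransit : ∀ {n} → Fun n → Set
IsTransit {n} R =
  (∀ (u v : Fin n) → u ∈ R u v) ×
  (∀ (u v : Fin n) → R u v ≡ R v u) ×
  (∀ (u : Fin n) → R u u ≡ ⁅ u ⁆)

Monotone : ∀ {n} → Fun n → Set
Monotone {n} R = ∀ (u v p q : Fin n) → p ∈ R u v → q ∈ R u v → R p q ⊆ R u v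

WP : ∀ {n} → Fun n → Set
WP {n} R = ∀ (u v x y p q : Fin n) →
  Nonempty (R u v ∩ R x y) → Nonempty (R u v ∩ R p q) → Nonempty (R x y ∩ R p q) →
  (R p q ⊆ R u v ∪ R x y) ⊎ (R u v ⊆ R p q ∪ R x y) ⊎ (R x y ⊆ R p q ∪ R u v)

O' : ∀ {n} → Fun n → Set
O' {n} R = ∀ (u v z : Fin n) → z ∈ R u v →
  ∃₂ λ (p q : Fin n) → p ∈ R u v × q ∈ R u v × (R p z ∪ R z q ≡ R u v)

{-# OPTIONS --safe #-}
module Submission where

-- Fix z ∈ R(u,v) and grow the set R(p,z) ∪ R(z,q), starting from p = q = z; by monotonicity it
-- stays inside R(u,v). If some w ∈ R(u,v) is missed, apply (wp) to R(p,z), R(z,q) and R(z,w),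
-- which pairwise meet in z: R(z,w) cannot be covered by the other two since it contains w, so
-- R(p,z) or R(z,q) is covered by the remaining two, and replacing p resp. q by w yields a
-- strictly larger set. By finiteness the growth stops, and then the set is all of R(u,v).

open import Defs
open import Data.Nat using (ℕ; suc)
open import Data.Fin using (Fin)
open import Data.Fin.Subset using (Subset; _∈_; _∉_; _⊆_; _⊂_; _⊃_; _∪_)
open import Data.Fin.Subset.Properties
  using (_∈?_; _⊂?_; ⊆-antisym; ∪-comm; p⊆p∪q; q⊆p∪q; x∈p∪q⁺; x∈p∪q⁻; x∈p∩q⁺)
open import Data.Fin.Subset.Induction using (⊃-wellFounded; Acc; acc)
open import Data.Product using (_×_; _,_; ∃; proj₁; proj₂; uncurry)
open import Data.Sum using (_⊎_; inj₁; inj₂; [_,_])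
open import Data.Empty using (⊥-elim)
open import Level using (Level)
open import Relation.Nullary using (yes; no; contradiction)
open import Relation.Binary.PropositionalEquality using (_≡_; subst)

private
  variable
    a ℓ : Level
    n : ℕ
    p q r : Subset n

∪-lub : p ⊆ r → q ⊆ r → p ∪ q ⊆ r
∪-lub {p = p} {q = q} p⊆r q⊆r x∈p∪q = [ p⊆r , q⊆r ] (x∈p∪q⁻ p q x∈p∪q)

⊆⇒≡⊎⊂ : p ⊆ q → p ≡ q ⊎ p ⊂ q
⊆⇒≡⊎⊂ {p = p} {q = q} p⊆q with p ⊂? q
... | yes p⊂q = inj₂ p⊂q
... | no  p⊄q = inj₁ (⊆-antisym p⊆q q⊆p)
  where
  q⊆p : q ⊆ p
  q⊆p {x} x∈q with x ∈? p
  ... | yes x∈p = x∈p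
  ... | no  x∉p = ⊥-elim (p⊄q (p⊆q , x , x∈q , x∉p))

saturate : {A : Set a} (P : A → Set ℓ) (f : A → Subset n) (S : Subset n) →
           (∀ {x} → P x → f x ⊆ S) →
           (∀ {x w} → P x → w ∈ S → w ∉ f x → ∃ λ y → P y × f x ⊂ f y) →
           ∀ {x} → P x → ∃ λ y → P y × f y ≡ S
saturate P f S bounded grow {x} Px = go Px (⊃-wellFounded (f x))
  where
  go : ∀ {x} → P x → Acc _⊃_ (f x) → ∃ λ y → P y × f y ≡ S
  go {x} Px (acc larger) with ⊆⇒≡⊎⊂ (bounded Px)
  ... | inj₁ fx≡S = x , Px , fx≡S
  ... | inj₂ (_ , w , w∈S , w∉fx) with grow Px w∈S w∉fx
  ...   | y , Py , fx⊂fy = go Py (larger fx⊂fy)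

module Transit {n} (R : Fun n) (transit : IsTransit R) where

  ∈-left : ∀ u v → u ∈ R u v
  ∈-left = proj₁ transit

  R-sym : ∀ u v → R u v ≡ R v u
  R-sym = proj₁ (proj₂ transit)

  ∈-right : ∀ u v → v ∈ R u v
  ∈-right u v = subst (v ∈_) (R-sym v u) (∈-left v u)

  module Through (z : Fin n) where

    Rᶻ : Fin n → Fin n → Subset n
    Rᶻ p q = R p z ∪ R z q

    Rᶻ⊆R : Monotone R → ∀ {u v p q} → z ∈ R u v → p ∈ R u v → q ∈ R u v → Rᶻ p q ⊆ R u v
    Rᶻ⊆R monotone {u} {v} {p} {q} z∈R p∈R q∈R =
      ∪-lub (monotone u v p z p∈R z∈R) (monotone u v z q z∈R q∈R)

    Rᶻ-grow : WP R → ∀ {p q w} → w ∉ Rᶻ p q → Rᶻ p q ⊂ Rᶻ w q ⊎ Rᶻ p q ⊂ Rᶻ p w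
    Rᶻ-grow wp {p} {q} {w} w∉Rᶻ
      with wp p z z q z w (z , x∈p∩q⁺ (∈-right p z , ∈-left z q))
                          (z , x∈p∩q⁺ (∈-right p z , ∈-left z w))
                          (z , x∈p∩q⁺ (∈-left z q , ∈-left z w))
    ... | inj₁ Rzw⊆Rᶻ = contradiction (Rzw⊆Rᶻ (∈-right z w)) w∉Rᶻ
    ... | inj₂ (inj₁ Rpz⊆Rzw∪Rzq) =
      inj₁ ( ∪-lub (subst (λ A → R p z ⊆ A ∪ R z q) (R-sym z w) Rpz⊆Rzw∪Rzq) (q⊆p∪q (R w z) (R z q))
           , w , x∈p∪q⁺ (inj₁ (∈-left w z)) , w∉Rᶻ)
    ... | inj₂ (inj₂ Rzq⊆Rzw∪Rpz) =
      inj₂ ( ∪-lub (p⊆p∪q (R z w)) (subst (R z q ⊆_) (∪-comm (R z w) (R p z)) Rzq⊆Rzw∪Rpz)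
           , w , x∈p∪q⁺ (inj₂ (∈-right z w)) , w∉Rᶻ)

    InR : Fin n → Fin n → Fin n × Fin n → Set
    InR u v (p , q) = p ∈ R u v × q ∈ R u v

    Rᶻ-saturates : Monotone R → WP R → ∀ {u v} → z ∈ R u v →
                   ∃ λ pq → InR u v pq × uncurry Rᶻ pq ≡ R u v
    Rᶻ-saturates monotone wp {u} {v} z∈R =
      saturate (InR u v) (uncurry Rᶻ) (R u v) bounded grow (z∈R , z∈R)
      where
      bounded : ∀ {pq} → InR u v pq → uncurry Rᶻ pq ⊆ R u v
      bounded (p∈R , q∈R) = Rᶻ⊆R monotone z∈R p∈R q∈R

      grow : ∀ {pq w} → InR u v pq → w ∈ R u v → w ∉ uncurry Rᶻ pq →
             ∃ λ pq′ → InR u v pq′ × uncurry Rᶻ pq ⊂ uncurry Rᶻ pq′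
      grow {p , q} {w} (p∈R , q∈R) w∈R w∉Rᶻ with Rᶻ-grow wp w∉Rᶻ
      ... | inj₁ Rᶻ⊂Rᶻ′ = (w , q) , (w∈R , q∈R) , Rᶻ⊂Rᶻ′
      ... | inj₂ Rᶻ⊂Rᶻ′ = (p , w) , (p∈R , w∈R) , Rᶻ⊂Rᶻ′

theorem5 : ∀ (m : ℕ) (R : Fun (suc m)) → IsTransit R → Monotone R → WP R → O' R
theorem5 _ R transit monotone wp u v z z∈R with Rᶻ-saturates monotone wp z∈R
  where open Transit R transit
        open Through z
... | (p , q) , (p∈R , q∈R) , Rᶻ≡R = p , q , p∈R , q∈R , Rᶻ≡R
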